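{- In the setting below, at least $n/2$ of the $n$ jobs have processing requirement at most $2^{ -c/6+2}$.
   Context: Setting: machines $M=\{1,\dots,m\}$ with speeds $s_1\ge s_2\ge\dots\ge s_m>0$ (unrestricted related machines), $n$ jobs with processing requirements $p_j\in[0,1]$; job $j$ on machine $i$ takes time $p_j/s_i$. For a schedule, $J_i$ is the set of jobs on machine $i$ and $L_i=\sum_{j\in J_i}p_j/s_i$ its load. $C^*>0$ is the optimal makespan. Fix a schedule $\sigma$ with makespan $C_{\max}(\sigma)$ that is a near list schedule: the jobs are indexed $1,\dots,n$ such that, with $J_{i,j}=J_i\cap\{1,\dots,j\}$, for all machines $i'\ne i$ and all $j\in J_i$: $L_{i'}+p_j/s_{i'}\ge L_i-\sum_{\ell\in J_{i,j-1}}p_\ell/s_i$ (all of $J_i,L_i,J_{i,j}$ refer to $\sigma$). Let $c=\lfloor C_{\max}(\sigma)/C^*\rfloor-1$.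
   Formalization: The speeds and the processing requirements $p_j$ take rational values, and the optimal makespan $C^*$ is taken in ℚ. -}

module Defs where

open import Data.Nat as ℕ using (ℕ; zero; suc)
import Data.Nat.Properties as ℕₚ
open import Data.Integer as ℤ using (ℤ; +_; -[1+_])
open import Data.Fin using (Fin; zero; suc; toℕ)
import Data.Fin as Fin
open import Data.Rational using (ℚ; 0ℚ; 1ℚ; _+_; _-_; _*_; _÷_; _≤_; _<_; _⊔_; floor; >-nonZero)
import Data.Rational as ℚ
open import Data.Rational.Properties using (_≤?_)
open import Data.Bool using (if_then_else_)
open import Data.Product using (Σ; _×_; ∃-syntax)
open import Data.Fin.Permutation using (Permutation′; _⟨$⟩ʳ_)
open import Relation.Nullary using (¬_; Dec; yes; no)
open import Relation.Nullary using (does)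
open import Relation.Binary.PropositionalEquality using (_≡_)

sumFin : (k : ℕ) → (Fin k → ℚ) → ℚ
sumFin zero    f = 0ℚ
sumFin (suc k) f = f zero + sumFin k (λ x → f (suc x))

-- finite maximum over Fin k (0 for k = 0; all quantities used are ≥ 0)
maxFin : (k : ℕ) → (Fin k → ℚ) → ℚ
maxFin zero    f = 0ℚ
maxFin (suc k) f = f zero ⊔ maxFin k (λ x → f (suc x))

countFin : (k : ℕ) → {P : Fin k → Set} → ((x : Fin k) → Dec (P x)) → ℕ
countFin zero    d = zero
countFin (suc k) d = (if does (d zero) then 1 else 0) ℕ.+ countFin k (λ x → d (suc x))

_^ℕ_ : ℚ → ℕ → ℚ
q ^ℕ zero  = 1ℚ
q ^ℕ suc k = q * (q ^ℕ k)

two : ℚ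
two = 1ℚ + 1ℚ

pow2ℤ : ℤ → ℚ
pow2ℤ (+ k)     = two ^ℕ k
pow2ℤ -[1+ k ]  = ℚ.½ ^ℕ suc k

-- For p ≥ 0, d ≥ 1:  "p ≤ 2^(z/d)"  is expressed as  p^d ≤ 2^z
-- (ℚ has no d-th roots; both sides are nonnegative so this is equivalent).
LeqPow2Frac : ℚ → ℤ → ℕ → Set
LeqPow2Frac q z d = (q ^ℕ d) ≤ pow2ℤ z

Schedule : ℕ → ℕ → Set
Schedule m n = Fin n → Fin m

module Scheduling (m n : ℕ) (s : Fin m → ℚ) (spos : ∀ i → 0ℚ < s i) (p : Fin n → ℚ) where

  onMachine : Fin m → ℚ → ℚ
  onMachine i q = _÷_ q (s i) {{>-nonZero (spos i)}}

  load : Schedule m n → Fin m → ℚ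
  load σ i = onMachine i (sumFin n (λ j → if does (σ j Fin.≟ i) then p j else 0ℚ))

  makespan : Schedule m n → ℚ
  makespan σ = maxFin m (load σ)

  IsOptimalMakespan : ℚ → Set
  IsOptimalMakespan C = (∃[ τ ] makespan τ ≡ C) × (∀ τ → C ≤ makespan τ)

  -- Σ_{ℓ ∈ J_{i,j-1}} p_ℓ, where the job order is given by the
  -- permutation π (job ℓ gets index π ⟨$⟩ʳ ℓ)
  earlierWork : Schedule m n → Permutation′ n → Fin m → Fin n → ℚ
  earlierWork σ π i j =
    sumFin n (λ ℓ → if does (σ ℓ Fin.≟ i)
                    then (if does (toℕ (π ⟨$⟩ʳ ℓ) ℕₚ.<? toℕ (π ⟨$⟩ʳ j)) then p ℓ else 0ℚ)
                    else 0ℚ)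

  NearListSchedule : Schedule m n → Set
  NearListSchedule σ = ∃[ π ] (∀ (i i' : Fin m) (j : Fin n) → ¬ (i' ≡ i) → σ j ≡ i →
      load σ i - onMachine i (earlierWork σ π i j) ≤ load σ i' + onMachine i' (p j))

-- Let C = C* and write R_j for the load of job j and the jobs after it on its machine in σ
-- (suffixLoad). The near-list property makes every machine i that could run job j within time D
-- carry work at least s_i (R_j − D), while in an optimal schedule the jobs of size at least w
-- weigh at most C·S_w, where S_w is the total speed of the machines with w ≤ s_i C. Comparing
-- the two bounds: if a job of size at most u has R_j above (N + 4)C, then some job of size at
-- most u/2 has R_j above NC; and if a job of size at most δ has R_j above 3C, then the jobs
-- larger than δ weigh no more, hence are no more numerous, than those of size at most δ.
-- A job with R_j just below the makespan (c + 1)C thus yields, after K = ⌈(c − 12)/6⌉ halvings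
-- from level c down to level 3, the threshold δ = 2^−K ≤ 2^(−c/6+2).

module Submission where

module Preliminaries where

  open import Data.Bool using (Bool; true; false; not; if_then_else_)
  open import Data.Empty using (⊥-elim)
  open import Data.Fin as Fin using (Fin; zero; suc)
  open import Data.Fin.Properties using (any?)
  open import Data.Integer as ℤ using (+_; -[1+_])
  import Data.Integer.DivMod as ℤ
  import Data.Integer.Properties as ℤ
  import Data.Integer.Tactic.RingSolver as ℤ
  open import Data.Nat as ℕ using (ℕ; zero; suc)
  import Data.Nat.Properties as ℕ
  open import Data.Product using (∃-syntax; _×_; _,_)
  open import Data.Rational as ℚ using (ℚ; mkℚ; 0ℚ; 1ℚ; ½; _+_; _*_; _-_; -_; _÷_; _≤_; _<_)
  import Data.Rational.Literals as ℚ
  open import Data.Rational.Properties as ℚ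
    using (_≤?_; _<?_; ≤-refl; ≤-trans; <-≤-trans; ≤-<-trans; <⇒≤; ≤-reflexive)
  open import Data.Rational.Solver using (module +-*-Solver)
  import Data.Rational.Unnormalised as ℚᵘ
  import Data.Rational.Unnormalised.Properties as ℚᵘ
  open import Function using (_∘_)
  open import Relation.Nullary using (¬_; Dec; yes; no; does)
  open import Relation.Nullary.Decidable using (_×-dec_; ¬?)
  open import Relation.Binary.PropositionalEquality

  open import Defs using (sumFin; maxFin; countFin; _^ℕ_)
  open +-*-Solver

  *-monoˡ-≤-nonNeg : ∀ {r a b} → 0ℚ ≤ r → a ≤ b → r * a ≤ r * b
  *-monoˡ-≤-nonNeg {r} 0≤r = ℚ.*-monoˡ-≤-nonNeg r {{ℚ.nonNegative 0≤r}}

  *-monoʳ-≤-nonNeg : ∀ {r a b} → 0ℚ ≤ r → a ≤ b → a * r ≤ b * r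
  *-monoʳ-≤-nonNeg {r} 0≤r = ℚ.*-monoʳ-≤-nonNeg r {{ℚ.nonNegative 0≤r}}

  *-monoˡ-<-pos : ∀ {r a b} → 0ℚ < r → a < b → r * a < r * b
  *-monoˡ-<-pos {r} 0<r = ℚ.*-monoʳ-<-pos r {{ℚ.positive 0<r}}

  *-nonneg : ∀ {a b} → 0ℚ ≤ a → 0ℚ ≤ b → 0ℚ ≤ a * b
  *-nonneg {a} {b} 0≤a 0≤b = subst (_≤ a * b) (ℚ.*-zeroʳ a) (*-monoˡ-≤-nonNeg 0≤a 0≤b)

  *-pos : ∀ {a b} → 0ℚ < a → 0ℚ < b → 0ℚ < a * b
  *-pos {a} {b} 0<a 0<b = subst (_< a * b) (ℚ.*-zeroʳ a) (*-monoˡ-<-pos 0<a 0<b)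

  -‿mono-≤ : ∀ {a b c d} → a ≤ b → d ≤ c → a - c ≤ b - d
  -‿mono-≤ a≤b d≤c = ℚ.+-mono-≤ a≤b (ℚ.neg-antimono-≤ d≤c)

  p-q≤p : ∀ p {q} → 0ℚ ≤ q → p - q ≤ p
  p-q≤p p {q} 0≤q = subst (p - q ≤_) (ℚ.+-identityʳ p) (-‿mono-≤ (≤-refl {p}) 0≤q)

  p<q⇒0<q-p : ∀ {p q} → p < q → 0ℚ < q - p
  p<q⇒0<q-p {p} {q} p<q = subst (_< q - p) (ℚ.+-inverseʳ p) (ℚ.+-monoˡ-< (- p) p<q)

  p+q-q≡p : ∀ p q → p + q - q ≡ p
  p+q-q≡p = solve 2 (λ p q → p :+ q :- q := p) refl

  p-[p-q]≡q : ∀ p q → p - (p - q) ≡ q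
  p-[p-q]≡q = solve 2 (λ p q → p :- (p :- q) := q) refl

  *-distribˡ-- : ∀ r p q → r * (p - q) ≡ r * p - r * q
  *-distribˡ-- = solve 3 (λ r p q → r :* (p :- q) := r :* p :- r :* q) refl

  +-cancelʳ-≤ : ∀ {p q} r → p + r ≤ q + r → p ≤ q
  +-cancelʳ-≤ {p} {q} r p+r≤q+r = subst₂ _≤_ (p+q-q≡p p r) (p+q-q≡p q r) (-‿mono-≤ p+r≤q+r (≤-refl {r}))

  p+p≰p : ∀ {p} → 0ℚ < p → ¬ (p + p ≤ p)
  p+p≰p {p} 0<p p+p≤p = ℚ.<-irrefl refl
    (<-≤-trans (subst (_< p + p) (ℚ.+-identityʳ p) (ℚ.+-monoʳ-< p 0<p)) p+p≤p)

  *-÷-cancel : ∀ q r .{{_ : ℚ.NonZero r}} → r * (q ÷ r) ≡ q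
  *-÷-cancel q r = trans (lemma r q (ℚ.1/ r)) (trans (cong (q *_) (ℚ.*-inverseʳ r)) (ℚ.*-identityʳ q))
    where
    lemma : ∀ r q i → r * (q * i) ≡ q * (r * i)
    lemma = solve 3 (λ r q i → r :* (q :* i) := q :* (r :* i)) refl

  when : Bool → ℚ → ℚ
  when b q = if b then q else 0ℚ

  when-nonneg : ∀ b {q} → 0ℚ ≤ q → 0ℚ ≤ when b q
  when-nonneg true  0≤q = 0≤q
  when-nonneg false _   = ≤-refl

  when-≤ : ∀ b {q} → 0ℚ ≤ q → when b q ≤ q
  when-≤ true  _   = ≤-refl
  when-≤ false 0≤q = 0≤q

  when-mono-≤ : ∀ {P : Set} (P? : Dec P) {q r} → (P → q ≤ r) → when (does P?) q ≤ when (does P?) r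
  when-mono-≤ (yes P) q≤r = q≤r P
  when-mono-≤ (no _)  _   = ≤-refl

  when-true : ∀ {P : Set} (P? : Dec P) {q} → P → when (does P?) q ≡ q
  when-true (yes _) _  = refl
  when-true (no ¬P) Pp = ⊥-elim (¬P Pp)

  when-implies : ∀ {P Q : Set} (P? : Dec P) (Q? : Dec Q) {q} → 0ℚ ≤ q → (P → Q) →
                 when (does P?) q ≤ when (does Q?) q
  when-implies (yes P) Q? 0≤q P⇒Q = ≤-reflexive (sym (when-true Q? (P⇒Q P)))
  when-implies (no _)  Q? 0≤q _   = when-nonneg (does Q?) 0≤q

  when-pos : ∀ {P : Set} (P? : Dec P) {q} → 0ℚ < when (does P?) q → P × 0ℚ < q
  when-pos (yes P) 0<q = P , 0<q
  when-pos (no _)  0<0 = ⊥-elim (ℚ.<-irrefl refl 0<0)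

  when-split : ∀ b q → q ≡ when b q + when (not b) q
  when-split true  q = sym (ℚ.+-identityʳ q)
  when-split false q = sym (ℚ.+-identityˡ q)

  *-when : ∀ b r q → r * when b q ≡ when b (r * q)
  *-when true  r q = refl
  *-when false r q = ℚ.*-zeroʳ r

  when-when : ∀ b c q → when b (when c q) ≡ when c (when b q)
  when-when true  c q = refl
  when-when false true  q = refl
  when-when false false q = refl

  sumFin-cong : ∀ k {f g : Fin k → ℚ} → (∀ x → f x ≡ g x) → sumFin k f ≡ sumFin k g
  sumFin-cong zero    _   = refl
  sumFin-cong (suc k) f≡g = cong₂ _+_ (f≡g zero) (sumFin-cong k (f≡g ∘ suc))

  sumFin-mono-≤ : ∀ k {f g : Fin k → ℚ} → (∀ x → f x ≤ g x) → sumFin k f ≤ sumFin k g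
  sumFin-mono-≤ zero    _   = ≤-refl
  sumFin-mono-≤ (suc k) f≤g = ℚ.+-mono-≤ (f≤g zero) (sumFin-mono-≤ k (f≤g ∘ suc))

  sumFin-zero : ∀ k → sumFin k (λ _ → 0ℚ) ≡ 0ℚ
  sumFin-zero zero    = refl
  sumFin-zero (suc k) = trans (ℚ.+-identityˡ _) (sumFin-zero k)

  sumFin-nonneg : ∀ k {f : Fin k → ℚ} → (∀ x → 0ℚ ≤ f x) → 0ℚ ≤ sumFin k f
  sumFin-nonneg k {f} 0≤f = subst (_≤ sumFin k f) (sumFin-zero k) (sumFin-mono-≤ k 0≤f)

  sumFin-distrib-+ : ∀ k (f g : Fin k → ℚ) →
                     sumFin k (λ x → f x + g x) ≡ sumFin k f + sumFin k g
  sumFin-distrib-+ zero    f g = sym (ℚ.+-identityˡ 0ℚ)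
  sumFin-distrib-+ (suc k) f g = trans
    (cong (_+_ (f zero + g zero)) (sumFin-distrib-+ k (f ∘ suc) (g ∘ suc)))
    (+-interchange (f zero) (g zero) _ _)
    where
    +-interchange : ∀ a b c d → (a + b) + (c + d) ≡ (a + c) + (b + d)
    +-interchange = solve 4 (λ a b c d → (a :+ b) :+ (c :+ d) := (a :+ c) :+ (b :+ d)) refl

  *-distribˡ-sumFin : ∀ k r (f : Fin k → ℚ) → r * sumFin k f ≡ sumFin k (λ x → r * f x)
  *-distribˡ-sumFin zero    r f = ℚ.*-zeroʳ r
  *-distribˡ-sumFin (suc k) r f =
    trans (ℚ.*-distribˡ-+ r _ _) (cong (_+_ (r * f zero)) (*-distribˡ-sumFin k r (f ∘ suc)))

  sumFin-comm : ∀ a b (f : Fin a → Fin b → ℚ) →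
                sumFin a (λ x → sumFin b (f x)) ≡ sumFin b (λ y → sumFin a (λ x → f x y))
  sumFin-comm zero    b f = sym (sumFin-zero b)
  sumFin-comm (suc a) b f = trans
    (cong (_+_ (sumFin b (f zero))) (sumFin-comm a b (f ∘ suc)))
    (sym (sumFin-distrib-+ b (f zero) (λ y → sumFin a (λ x → f (suc x) y))))

  sumFin-≥-term : ∀ k (f : Fin k → ℚ) → (∀ x → 0ℚ ≤ f x) → ∀ x → f x ≤ sumFin k f
  sumFin-≥-term (suc k) f 0≤f zero = subst (_≤ sumFin (suc k) f) (ℚ.+-identityʳ (f zero))
    (ℚ.+-monoʳ-≤ (f zero) (sumFin-nonneg k (0≤f ∘ suc)))
  sumFin-≥-term (suc k) f 0≤f (suc x) = subst (_≤ sumFin (suc k) f) (ℚ.+-identityˡ (f (suc x)))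
    (ℚ.+-mono-≤ (0≤f zero) (sumFin-≥-term k (f ∘ suc) (0≤f ∘ suc) x))

  sumFin-pos⇒term-pos : ∀ k (f : Fin k → ℚ) → 0ℚ < sumFin k f → ∃[ x ] 0ℚ < f x
  sumFin-pos⇒term-pos k f 0<Σf with any? (λ x → 0ℚ <? f x)
  ... | yes pos = pos
  ... | no ¬pos = ⊥-elim (ℚ.<-irrefl refl (<-≤-trans 0<Σf
        (subst (sumFin k f ≤_) (sumFin-zero k)
          (sumFin-mono-≤ k (λ x → ℚ.≮⇒≥ (λ 0<fx → ¬pos (x , 0<fx)))))))

  sumFin-indicator : ∀ k (i : Fin k) (f : Fin k → ℚ) →
                     sumFin k (λ x → when (does (i Fin.≟ x)) (f x)) ≡ f i
  sumFin-indicator (suc k) zero    f =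
    trans (cong (_+_ (f zero)) (sumFin-zero k)) (ℚ.+-identityʳ (f zero))
  sumFin-indicator (suc k) (suc i) f = trans (ℚ.+-identityˡ _) (sumFin-indicator k i (f ∘ suc))

  when-sumFin : ∀ b k (f : Fin k → ℚ) → when b (sumFin k f) ≡ sumFin k (λ x → when b (f x))
  when-sumFin true  k f = refl
  when-sumFin false k f = sym (sumFin-zero k)

  sumFin-fibres : ∀ m n (ρ : Fin n → Fin m) (b : Fin m → Bool) (f : Fin n → ℚ) →
    sumFin m (λ i → when (b i) (sumFin n (λ j → when (does (ρ j Fin.≟ i)) (f j))))
    ≡ sumFin n (λ j → when (b (ρ j)) (f j))
  sumFin-fibres m n ρ b f = begin
    sumFin m (λ i → when (b i) (sumFin n (λ j → when (does (ρ j Fin.≟ i)) (f j))))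
      ≡⟨ sumFin-cong m (λ i → when-sumFin (b i) n _) ⟩
    sumFin m (λ i → sumFin n (λ j → when (b i) (when (does (ρ j Fin.≟ i)) (f j))))
      ≡⟨ sumFin-comm m n _ ⟩
    sumFin n (λ j → sumFin m (λ i → when (b i) (when (does (ρ j Fin.≟ i)) (f j))))
      ≡⟨ sumFin-cong n (λ j → sumFin-cong m (λ i → when-when (b i) _ (f j))) ⟩
    sumFin n (λ j → sumFin m (λ i → when (does (ρ j Fin.≟ i)) (when (b i) (f j))))
      ≡⟨ sumFin-cong n (λ j → sumFin-indicator m (ρ j) (λ i → when (b i) (f j))) ⟩
    sumFin n (λ j → when (b (ρ j)) (f j)) ∎
    where open ≡-Reasoning

  fromℕ : ℕ → ℚ
  fromℕ N = ℚ.fromℤ (+ N)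

  fromℕ-suc : ∀ N → fromℕ (suc N) ≡ 1ℚ + fromℕ N
  fromℕ-suc N = ℚ.toℚᵘ-injective (ℚᵘ.≃-trans
    (ℚᵘ.*≡* (cross-multiplied (+ N)))
    (ℚᵘ.≃-sym (ℚ.toℚᵘ-homo-+ 1ℚ (fromℕ N))))
    where
    cross-multiplied : ∀ i → (+ 1 ℤ.+ i) ℤ.* + 1 ≡ (+ 1 ℤ.* + 1 ℤ.+ i ℤ.* + 1) ℤ.* + 1
    cross-multiplied = ℤ.solve-∀

  fromℕ-cancel-≤ : ∀ {a b} → fromℕ a ≤ fromℕ b → a ℕ.≤ b
  fromℕ-cancel-≤ {a} {b} a≤b with ℚ.drop-*≤* a≤b
  ... | a*1≤b*1 rewrite ℤ.*-identityʳ (+ a) | ℤ.*-identityʳ (+ b) = ℤ.drop‿+≤+ a*1≤b*1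

  floor≡⇒fromℕ≤ : ∀ q N → ℚ.floor q ≡ + N → fromℕ N ≤ q
  floor≡⇒fromℕ≤ (mkℚ a d _) N ⌊q⌋≡N = ℚ.*≤* (subst₂ ℤ._≤_
    (cong (ℤ._* + suc d) ⌊q⌋≡N) (sym (ℤ.*-identityʳ a)) (ℤ.[n/d]*d≤n a (+ suc d)))

  sumFin-when-const : ∀ k {P : Fin k → Set} (P? : ∀ x → Dec (P x)) q →
                      sumFin k (λ x → when (does (P? x)) q) ≡ fromℕ (countFin k P?) * q
  sumFin-when-const zero    P? q = sym (ℚ.*-zeroˡ q)
  sumFin-when-const (suc k) P? q with does (P? zero)
  ... | true  = begin
    q + sumFin k (λ x → when (does (P? (suc x))) q)  ≡⟨ cong (_+_ q) (sumFin-when-const k (P? ∘ suc) q) ⟩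
    q + fromℕ (countFin k (P? ∘ suc)) * q            ≡⟨ +-*-factor q (fromℕ (countFin k (P? ∘ suc))) ⟩
    (1ℚ + fromℕ (countFin k (P? ∘ suc))) * q          ≡⟨ cong (_* q) (fromℕ-suc _) ⟨
    fromℕ (suc (countFin k (P? ∘ suc))) * q           ∎
    where
    open ≡-Reasoning
    +-*-factor : ∀ q c → q + c * q ≡ (1ℚ + c) * q
    +-*-factor = solve 2 (λ q c → q :+ c :* q := (con 1ℚ :+ c) :* q) refl
  ... | false = trans (ℚ.+-identityˡ _) (sumFin-when-const k (P? ∘ suc) q)

  countFin-+-complement : ∀ k {P : Fin k → Set} (P? : ∀ x → Dec (P x)) →
                          countFin k P? ℕ.+ countFin k (¬? ∘ P?) ≡ k
  countFin-+-complement zero    P? = refl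
  countFin-+-complement (suc k) P? with does (P? zero)
  ... | true  = cong suc (countFin-+-complement k (P? ∘ suc))
  ... | false = trans (ℕ.+-suc _ _) (cong suc (countFin-+-complement k (P? ∘ suc)))

  countFin-mono : ∀ k {P Q : Fin k → Set} (P? : ∀ x → Dec (P x)) (Q? : ∀ x → Dec (Q x)) →
                  (∀ x → P x → Q x) → countFin k P? ℕ.≤ countFin k Q?
  countFin-mono zero    P? Q? P⇒Q = ℕ.z≤n
  countFin-mono (suc k) P? Q? P⇒Q with P? zero | Q? zero
  ... | yes _  | yes _  = ℕ.s≤s (countFin-mono k (P? ∘ suc) (Q? ∘ suc) (P⇒Q ∘ suc))
  ... | yes P0 | no ¬Q0 = ⊥-elim (¬Q0 (P⇒Q zero P0))
  ... | no _   | yes _  = ℕ.m≤n⇒m≤1+n (countFin-mono k (P? ∘ suc) (Q? ∘ suc) (P⇒Q ∘ suc))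
  ... | no _   | no _   = countFin-mono k (P? ∘ suc) (Q? ∘ suc) (P⇒Q ∘ suc)

  countFin-all : ∀ k {P : Fin k → Set} (P? : ∀ x → Dec (P x)) → (∀ x → P x) → countFin k P? ≡ k
  countFin-all zero    P? _   = refl
  countFin-all (suc k) P? all with P? zero
  ... | yes _   = cong suc (countFin-all k (P? ∘ suc) (all ∘ suc))
  ... | no ¬P0  = ⊥-elim (¬P0 (all zero))

  maxFin-≥ : ∀ k (f : Fin k → ℚ) i → f i ≤ maxFin k f
  maxFin-≥ (suc k) f zero    = ℚ.p≤p⊔q (f zero) _
  maxFin-≥ (suc k) f (suc i) = ≤-trans (maxFin-≥ k (f ∘ suc) i) (ℚ.p≤q⊔p (f zero) _)

  <maxFin⇒<term : ∀ k (f : Fin k → ℚ) {x} → 0ℚ ≤ x → x < maxFin k f → ∃[ i ] x < f i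
  <maxFin⇒<term zero    f 0≤x x<0 = ⊥-elim (ℚ.<-irrefl refl (≤-<-trans 0≤x x<0))
  <maxFin⇒<term (suc k) f {x} 0≤x x<max with f zero ≤? maxFin k (f ∘ suc)
  ... | yes f0≤M with <maxFin⇒<term k (f ∘ suc) 0≤x (subst (x <_) (ℚ.p≤q⇒p⊔q≡q f0≤M) x<max)
  ...   | i , x<fi = suc i , x<fi
  <maxFin⇒<term (suc k) f {x} 0≤x x<max | no f0≰M =
    zero , subst (x <_) (ℚ.p≥q⇒p⊔q≡p (<⇒≤ (ℚ.≰⇒> f0≰M))) x<max

  0≤1 : 0ℚ ≤ 1ℚ
  0≤1 = ℚ.*≤* (ℤ.+≤+ ℕ.z≤n)

  0<1 : 0ℚ < 1ℚ
  0<1 = ℚ.*<* (ℤ.+<+ (ℕ.s≤s ℕ.z≤n))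

  ^ℕ-nonneg : ∀ {q} k → 0ℚ ≤ q → 0ℚ ≤ q ^ℕ k
  ^ℕ-nonneg zero    _   = 0≤1
  ^ℕ-nonneg (suc k) 0≤q = *-nonneg 0≤q (^ℕ-nonneg k 0≤q)

  ^ℕ-mono-≤ : ∀ {a b} k → 0ℚ ≤ a → a ≤ b → a ^ℕ k ≤ b ^ℕ k
  ^ℕ-mono-≤ zero    _   _   = ≤-refl
  ^ℕ-mono-≤ {a} {b} (suc k) 0≤a a≤b = ≤-trans
    (*-monoʳ-≤-nonNeg (^ℕ-nonneg k 0≤a) a≤b)
    (*-monoˡ-≤-nonNeg (≤-trans 0≤a a≤b) (^ℕ-mono-≤ k 0≤a a≤b))

  ^ℕ-+ : ∀ q a b → q ^ℕ (a ℕ.+ b) ≡ q ^ℕ a * q ^ℕ b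
  ^ℕ-+ q zero    b = sym (ℚ.*-identityˡ _)
  ^ℕ-+ q (suc a) b = trans (cong (q *_) (^ℕ-+ q a b)) (sym (ℚ.*-assoc q _ _))

  ^ℕ-* : ∀ q a b → (q ^ℕ a) ^ℕ b ≡ q ^ℕ (a ℕ.* b)
  ^ℕ-* q a zero    = cong (q ^ℕ_) (sym (ℕ.*-zeroʳ a))
  ^ℕ-* q a (suc b) = begin
    q ^ℕ a * (q ^ℕ a) ^ℕ b   ≡⟨ cong (q ^ℕ a *_) (^ℕ-* q a b) ⟩
    q ^ℕ a * q ^ℕ (a ℕ.* b)  ≡⟨ ^ℕ-+ q a (a ℕ.* b) ⟨
    q ^ℕ (a ℕ.+ a ℕ.* b)     ≡⟨ cong (q ^ℕ_) (ℕ.*-suc a b) ⟨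
    q ^ℕ (a ℕ.* suc b)       ∎
    where open ≡-Reasoning

  1^ℕ : ∀ k → 1ℚ ^ℕ k ≡ 1ℚ
  1^ℕ zero    = refl
  1^ℕ (suc k) = trans (ℚ.*-identityˡ _) (1^ℕ k)

  ^ℕ-≤-1 : ∀ {q} k → 0ℚ ≤ q → q ≤ 1ℚ → q ^ℕ k ≤ 1ℚ
  ^ℕ-≤-1 {q} k 0≤q q≤1 = subst (q ^ℕ k ≤_) (1^ℕ k) (^ℕ-mono-≤ k 0≤q q≤1)

  1≤^ℕ : ∀ {q} k → 1ℚ ≤ q → 1ℚ ≤ q ^ℕ k
  1≤^ℕ {q} k 1≤q = subst (_≤ q ^ℕ k) (1^ℕ k) (^ℕ-mono-≤ k 0≤1 1≤q)

  0<½ : 0ℚ < ½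
  0<½ = ℚ.*<* (ℤ.+<+ (ℕ.s≤s ℕ.z≤n))

  ½≤1 : ½ ≤ 1ℚ
  ½≤1 = ℚ.*≤* (ℤ.+≤+ (ℕ.s≤s ℕ.z≤n))

  ½^-pos : ∀ k → 0ℚ < ½ ^ℕ k
  ½^-pos zero    = 0<1
  ½^-pos (suc k) = *-pos 0<½ (½^-pos k)

  ½^-antimono : ∀ {a b} → a ℕ.≤ b → ½ ^ℕ b ≤ ½ ^ℕ a
  ½^-antimono {a} a≤b with ℕ.m≤n⇒∃[o]m+o≡n a≤b
  ... | o , refl = begin
    ½ ^ℕ (a ℕ.+ o)     ≡⟨ ^ℕ-+ ½ a o ⟩
    ½ ^ℕ a * ½ ^ℕ o    ≤⟨ *-monoˡ-≤-nonNeg (<⇒≤ (½^-pos a)) (^ℕ-≤-1 o (<⇒≤ 0<½) ½≤1) ⟩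
    ½ ^ℕ a * 1ℚ        ≡⟨ ℚ.*-identityʳ _ ⟩
    ½ ^ℕ a             ∎
    where open ℚ.≤-Reasoning

  least-witness : ∀ {n} {P : Fin n → Set} → (∀ j → Dec (P j)) → (rank : Fin n → ℕ) →
                  ∀ {j} → P j → ∃[ i ] P i × (∀ ℓ → rank ℓ ℕ.< rank i → ¬ P ℓ)
  least-witness {P = P} P? rank {j} Pj = descend (suc (rank j)) (ℕ.n<1+n (rank j)) Pj
    where
    descend : ∀ r {j} → rank j ℕ.< r → P j → ∃[ i ] P i × (∀ ℓ → rank ℓ ℕ.< rank i → ¬ P ℓ)
    descend (suc r) {j} j<r Pj with any? (λ ℓ → P? ℓ ×-dec rank ℓ ℕ.<? rank j)
    ... | yes (ℓ , Pℓ , ℓ<j) = descend r (ℕ.<-≤-trans ℓ<j (ℕ.≤-pred j<r)) Pℓ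
    ... | no none            = j , Pj , λ ℓ ℓ<j Pℓ → none (ℓ , Pℓ , ℓ<j)

  half-light-by-weight : ∀ k (f : Fin k → ℚ) {δ} → 0ℚ < δ →
    sumFin k (λ x → when (does (¬? (f x ≤? δ))) (f x)) ≤ sumFin k (λ x → when (does (f x ≤? δ)) (f x)) →
    k ℕ.≤ 2 ℕ.* countFin k (λ x → f x ≤? δ)
  half-light-by-weight k f {δ} 0<δ heavy≤light = subst₂ ℕ._≤_
    (countFin-+-complement k light?) (cong (ℕ._+_ #light) (sym (ℕ.+-identityʳ #light)))
    (ℕ.+-monoʳ-≤ #light (fromℕ-cancel-≤ (ℚ.*-cancelʳ-≤-pos δ {{ℚ.positive 0<δ}} #heavy*δ≤#light*δ)))
    where
    open ℚ.≤-Reasoning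
    light? : ∀ x → Dec (f x ≤ δ)
    light? x = f x ≤? δ
    #light = countFin k light?
    #heavy = countFin k (¬? ∘ light?)
    #heavy*δ≤#light*δ : fromℕ #heavy * δ ≤ fromℕ #light * δ
    #heavy*δ≤#light*δ = begin
      fromℕ #heavy * δ                                  ≡⟨ sumFin-when-const k (¬? ∘ light?) δ ⟨
      sumFin k (λ x → when (does (¬? (light? x))) δ)    ≤⟨ sumFin-mono-≤ k (λ x →
                                                            when-mono-≤ (¬? (light? x)) (<⇒≤ ∘ ℚ.≰⇒>)) ⟩
      sumFin k (λ x → when (does (¬? (light? x))) (f x)) ≤⟨ heavy≤light ⟩
      sumFin k (λ x → when (does (light? x)) (f x))     ≤⟨ sumFin-mono-≤ k (λ x →
                                                            when-mono-≤ (light? x) (λ fx≤δ → fx≤δ)) ⟩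
      sumFin k (λ x → when (does (light? x)) δ)         ≡⟨ sumFin-when-const k light? δ ⟩
      fromℕ #light * δ                                  ∎

  halvings : ∀ d → ∃[ K ] suc d ℕ.≤ K ℕ.* 6 × K ℕ.* 4 ℕ.+ 3 ℕ.≤ 13 ℕ.+ d
  halvings d with d ℕ.<? 6
  ... | yes d<6 = 1 , d<6 , ℕ.≤-trans (ℕ.m≤m+n 7 6) (ℕ.m≤m+n 13 d)
  ... | no d≮6 with ℕ.m≤n⇒∃[o]m+o≡n (ℕ.≮⇒≥ d≮6)
  ...   | e , refl with halvings e
  ...     | K , e<6K , 4K+3≤13+e =
    suc K , ℕ.+-monoʳ-≤ 6 e<6K , ℕ.≤-trans (ℕ.+-monoʳ-≤ 4 4K+3≤13+e) (ℕ.m≤n+m (17 ℕ.+ e) 2)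

  12-[f-1]≡-[1+d]⇒f≡14+d : ∀ f d → + 12 ℤ.- (f ℤ.- + 1) ≡ -[1+ d ] → f ≡ + (14 ℕ.+ d)
  12-[f-1]≡-[1+d]⇒f≡14+d f d e = trans (unfold f) (cong (ℤ._-_ (+ 13)) e)
    where
    unfold : ∀ f → f ≡ + 13 ℤ.- (+ 12 ℤ.- (f ℤ.- + 1))
    unfold = ℤ.solve-∀

module RelatedMachines where

  open import Data.Bool using (true)
  open import Data.Empty using (⊥-elim)
  open import Data.Fin as Fin using (Fin; toℕ)
  open import Data.Fin.Properties using (any?)
  open import Data.Fin.Permutation using (Permutation′; _⟨$⟩ʳ_)
  open import Data.Integer as ℤ using (+_; -[1+_])
  open import Data.Nat as ℕ using (ℕ; zero; suc)
  import Data.Nat.Properties as ℕ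
  open import Data.Product using (∃-syntax; _×_; _,_; proj₁; proj₂)
  open import Data.Rational as ℚ using (ℚ; 0ℚ; 1ℚ; ½; _+_; _*_; _-_; _÷_; _≤_; _<_; >-nonZero)
  open import Data.Rational.Properties as ℚ
    using (_≤?_; _<?_; ≤-refl; ≤-trans; <-≤-trans; ≤-<-trans; <⇒≤; ≤-reflexive)
  open import Data.Rational.Solver using (module +-*-Solver)
  open import Function using (_∘_)
  open import Relation.Nullary using (¬_; Dec; yes; no; does)
  open import Relation.Nullary.Decidable using (_×-dec_; ¬?)
  open import Relation.Binary.PropositionalEquality

  open import Defs
  open +-*-Solver
  open Preliminaries

  module NearListBounds (m n : ℕ) (s : Fin m → ℚ) (spos : ∀ i → 0ℚ < s i) (p : Fin n → ℚ)
                        (0≤p : ∀ j → 0ℚ ≤ p j) where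

    open Scheduling m n s spos p

    0≤s : ∀ i → 0ℚ ≤ s i
    0≤s i = <⇒≤ (spos i)

    work : Schedule m n → Fin m → ℚ
    work ρ i = sumFin n (λ j → when (does (ρ j Fin.≟ i)) (p j))

    s*onMachine : ∀ i q → s i * onMachine i q ≡ q
    s*onMachine i q = *-÷-cancel q (s i) {{>-nonZero (spos i)}}

    s*load : ∀ ρ i → s i * load ρ i ≡ work ρ i
    s*load ρ i = s*onMachine i (work ρ i)

    job≤work : ∀ ρ j → p j ≤ work ρ (ρ j)
    job≤work ρ j = subst (_≤ work ρ (ρ j)) (when-true (ρ j Fin.≟ ρ j) refl)
      (sumFin-≥-term n _ (λ ℓ → when-nonneg _ (0≤p ℓ)) j)

    all-jobs-light : (∀ j → p j ≤ 1ℚ) → ∀ k → n ℕ.≤ 2 ℕ.* countFin n (λ j → (p j ^ℕ 6) ≤? pow2ℤ (+ k))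
    all-jobs-light p≤1 k = subst (λ c → n ℕ.≤ 2 ℕ.* c) (sym (countFin-all n _ light)) (ℕ.m≤n*m n 2)
      where
      light : ∀ j → p j ^ℕ 6 ≤ two ^ℕ k
      light j = ≤-trans (^ℕ-≤-1 6 (0≤p j) (p≤1 j)) (1≤^ℕ k (ℚ.*≤* (ℤ.+≤+ (ℕ.s≤s ℕ.z≤n))))

    module Optimum (C : ℚ) (0<C : 0ℚ < C) (τ : Schedule m n) (load-τ≤C : ∀ i → load τ i ≤ C) where

      private instance
        C≢0 : ℚ.NonZero C
        C≢0 = >-nonZero 0<C

      work-τ≤ : ∀ i → work τ i ≤ s i * C
      work-τ≤ i = subst (_≤ s i * C) (s*load τ i) (*-monoˡ-≤-nonNeg (0≤s i) (load-τ≤C i))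

      job≤speed*C : ∀ j → p j ≤ s (τ j) * C
      job≤speed*C j = ≤-trans (job≤work τ j) (work-τ≤ (τ j))

      fastSpeed : ℚ → ℚ
      fastSpeed w = sumFin m (λ i → when (does (w ≤? s i * C)) (s i))

      speed≤fastSpeed : ∀ {w} i → w ≤ s i * C → s i ≤ fastSpeed w
      speed≤fastSpeed {w} i fits = subst (_≤ fastSpeed w) (when-true (w ≤? s i * C) fits)
        (sumFin-≥-term m _ (λ k → when-nonneg _ (0≤s k)) i)

      big-jobs-work : ∀ w {Q : Fin n → Set} (Q? : ∀ j → Dec (Q j)) → (∀ j → Q j → w ≤ p j) →
                      sumFin n (λ j → when (does (Q? j)) (p j)) ≤ C * fastSpeed w
      big-jobs-work w Q? big = begin
        sumFin n (λ j → when (does (Q? j)) (p j))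
          ≤⟨ sumFin-mono-≤ n (λ j → when-implies (Q? j) (fits? (τ j)) (0≤p j)
               (λ Qj → ≤-trans (big j Qj) (job≤speed*C j))) ⟩
        sumFin n (λ j → when (does (fits? (τ j))) (p j))
          ≡⟨ sumFin-fibres m n τ (does ∘ fits?) p ⟨
        sumFin m (λ i → when (does (fits? i)) (work τ i))
          ≤⟨ sumFin-mono-≤ m (λ i → when-mono-≤ (fits? i) (λ _ → work-τ≤ i)) ⟩
        sumFin m (λ i → when (does (fits? i)) (s i * C))
          ≡⟨ sumFin-cong m (λ i → trans (cong (when _) (ℚ.*-comm (s i) C)) (sym (*-when _ C (s i)))) ⟩
        sumFin m (λ i → C * when (does (fits? i)) (s i))
          ≡⟨ *-distribˡ-sumFin m C _ ⟨
        C * fastSpeed w ∎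
        where
        open ℚ.≤-Reasoning
        fits? : ∀ i → Dec (w ≤ s i * C)
        fits? i = w ≤? s i * C

      level : ℕ → ℚ
      level zero    = 0ℚ
      level (suc N) = C + level N

      level-nonneg : ∀ N → 0ℚ ≤ level N
      level-nonneg zero    = ≤-refl
      level-nonneg (suc N) = subst (_≤ level (suc N)) (ℚ.+-identityʳ 0ℚ)
        (ℚ.+-mono-≤ (<⇒≤ 0<C) (level-nonneg N))

      level-mono : ∀ {a b} → a ℕ.≤ b → level a ≤ level b
      level-mono {b = b} ℕ.z≤n = level-nonneg b
      level-mono (ℕ.s≤s a≤b)   = ℚ.+-monoʳ-≤ C (level-mono a≤b)

      level≡fromℕ*C : ∀ N → level N ≡ fromℕ N * C
      level≡fromℕ*C zero    = sym (ℚ.*-zeroˡ C)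
      level≡fromℕ*C (suc N) = begin
        C + level N                ≡⟨ cong (_+_ C) (level≡fromℕ*C N) ⟩
        C + fromℕ N * C            ≡⟨ distrib C (fromℕ N) ⟩
        (1ℚ + fromℕ N) * C         ≡⟨ cong (_* C) (fromℕ-suc N) ⟨
        fromℕ (suc N) * C          ∎
        where
        open ≡-Reasoning
        distrib : ∀ c a → c + a * c ≡ (1ℚ + a) * c
        distrib = solve 2 (λ c a → c :+ a :* c := (con 1ℚ :+ a) :* c) refl

      floor≡⇒level≤ : ∀ M N → ℚ.floor (M ÷ C) ≡ + N → level N ≤ M
      floor≡⇒level≤ M N ⌊M/C⌋≡N = begin
        level N        ≡⟨ level≡fromℕ*C N ⟩
        fromℕ N * C    ≤⟨ *-monoʳ-≤-nonNeg (<⇒≤ 0<C) (floor≡⇒fromℕ≤ (M ÷ C) N ⌊M/C⌋≡N) ⟩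
        (M ÷ C) * C    ≡⟨ ℚ.*-comm (M ÷ C) C ⟩
        C * (M ÷ C)    ≡⟨ *-÷-cancel M C ⟩
        M              ∎
        where open ℚ.≤-Reasoning

    module NearList (σ : Schedule m n) (π : Permutation′ n)
      (near : ∀ i i' j → ¬ i' ≡ i → σ j ≡ i →
              load σ i - onMachine i (earlierWork σ π i j) ≤ load σ i' + onMachine i' (p j)) where

      suffixLoad : Fin n → ℚ
      suffixLoad j = load σ (σ j) - onMachine (σ j) (earlierWork σ π (σ j) j)

      rank : Fin n → ℕ
      rank j = toℕ (π ⟨$⟩ʳ j)

      s*suffixLoad : ∀ {i j} → σ j ≡ i → s i * suffixLoad j ≡ work σ i - earlierWork σ π i j
      s*suffixLoad {i} {j} refl = trans (*-distribˡ-- (s i) _ _)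
        (cong₂ _-_ (s*load σ i) (s*onMachine i (earlierWork σ π i j)))

      s*suffixLoad≤work : ∀ j → s (σ j) * suffixLoad j ≤ work σ (σ j)
      s*suffixLoad≤work j = subst (_≤ work σ (σ j)) (sym (s*suffixLoad refl))
        (p-q≤p _ (sumFin-nonneg n (λ ℓ → when-nonneg (does (σ ℓ Fin.≟ σ j))
          (when-nonneg (does (rank ℓ ℕ.<? rank j)) (0≤p ℓ)))))

      s*suffixLoad≤work+p : ∀ j i → ¬ i ≡ σ j → s i * suffixLoad j ≤ work σ i + p j
      s*suffixLoad≤work+p j i i≢σj = subst (s i * suffixLoad j ≤_)
        (trans (ℚ.*-distribˡ-+ (s i) _ _) (cong₂ _+_ (s*load σ i) (s*onMachine i (p j))))
        (*-monoˡ-≤-nonNeg (0≤s i) (near (σ j) i j i≢σj refl))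

      work-lower-bound : ∀ {x D j} i → x < suffixLoad j → 0ℚ ≤ D → p j ≤ s i * D →
                         s i * (x - D) ≤ work σ i
      work-lower-bound {x} {D} {j} i x<R 0≤D pj≤sD with i Fin.≟ σ j
      ... | yes refl = begin
        s i * (x - D)        ≤⟨ *-monoˡ-≤-nonNeg (0≤s i) (p-q≤p x 0≤D) ⟩
        s i * x              <⟨ *-monoˡ-<-pos (spos i) x<R ⟩
        s i * suffixLoad j   ≤⟨ s*suffixLoad≤work j ⟩
        work σ i             ∎
        where open ℚ.≤-Reasoning
      ... | no i≢σj = begin
        s i * (x - D)              ≡⟨ *-distribˡ-- (s i) x D ⟩
        s i * x - s i * D          ≤⟨ -‿mono-≤ (<⇒≤ (*-monoˡ-<-pos (spos i) x<R)) pj≤sD ⟩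
        s i * suffixLoad j - p j   ≤⟨ -‿mono-≤ (s*suffixLoad≤work+p j i i≢σj) (≤-refl {p j}) ⟩
        work σ i + p j - p j       ≡⟨ p+q-q≡p (work σ i) (p j) ⟩
        work σ i                   ∎
        where open ℚ.≤-Reasoning

      workAbove : ℚ → Fin m → ℚ
      workAbove y i = sumFin n (λ ℓ → when (does (σ ℓ Fin.≟ i)) (when (does (y <? suffixLoad ℓ)) (p ℓ)))

      workAbove-nonneg : ∀ y i → 0ℚ ≤ workAbove y i
      workAbove-nonneg y i = sumFin-nonneg n (λ ℓ → when-nonneg (does (σ ℓ Fin.≟ i))
        (when-nonneg (does (y <? suffixLoad ℓ)) (0≤p ℓ)))

      lowJobOn? : ∀ y i ℓ → Dec (σ ℓ ≡ i × suffixLoad ℓ ≤ y)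
      lowJobOn? y i ℓ = (σ ℓ Fin.≟ i) ×-dec (suffixLoad ℓ ≤? y)

      -- The jobs on i with suffix load above y form a prefix of its job list, and the work
      -- before the first job after that prefix is at least work σ i − s i * y.
      workAbove-≥ : ∀ {y} i → 0ℚ ≤ y → work σ i - s i * y ≤ workAbove y i
      workAbove-≥ {y} i 0≤y with any? (lowJobOn? y i)
      ... | yes (_ , lowⱼ) with least-witness (lowJobOn? y i) rank lowⱼ
      ...   | j , (σj≡i , Rj≤y) , below = begin
        work σ i - s i * y
          ≤⟨ -‿mono-≤ (≤-refl {work σ i}) (*-monoˡ-≤-nonNeg (0≤s i) Rj≤y) ⟩
        work σ i - s i * suffixLoad j
          ≡⟨ cong (_-_ (work σ i)) (s*suffixLoad σj≡i) ⟩
        work σ i - (work σ i - earlierWork σ π i j)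
          ≡⟨ p-[p-q]≡q (work σ i) _ ⟩
        earlierWork σ π i j
          ≤⟨ sumFin-mono-≤ n earlier⇒above ⟩
        workAbove y i ∎
        where
        open ℚ.≤-Reasoning
        earlier⇒above : ∀ ℓ → when (does (σ ℓ Fin.≟ i)) (when (does (rank ℓ ℕ.<? rank j)) (p ℓ))
                            ≤ when (does (σ ℓ Fin.≟ i)) (when (does (y <? suffixLoad ℓ)) (p ℓ))
        earlier⇒above ℓ = when-mono-≤ (σ ℓ Fin.≟ i) (λ σℓ≡i →
          when-implies (rank ℓ ℕ.<? rank j) (y <? suffixLoad ℓ) (0≤p ℓ)
            (λ ℓ<j → ℚ.≰⇒> (λ Rℓ≤y → below ℓ ℓ<j (σℓ≡i , Rℓ≤y))))
      workAbove-≥ {y} i 0≤y | no none = begin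
        work σ i - s i * y   ≤⟨ p-q≤p (work σ i) (*-nonneg (0≤s i) 0≤y) ⟩
        work σ i             ≤⟨ sumFin-mono-≤ n on-i⇒above ⟩
        workAbove y i        ∎
        where
        open ℚ.≤-Reasoning
        on-i⇒above : ∀ ℓ → when (does (σ ℓ Fin.≟ i)) (p ℓ)
                         ≤ when (does (σ ℓ Fin.≟ i)) (when (does (y <? suffixLoad ℓ)) (p ℓ))
        on-i⇒above ℓ = when-mono-≤ (σ ℓ Fin.≟ i) (λ σℓ≡i → ≤-reflexive (sym
          (when-true (y <? suffixLoad ℓ) (ℚ.≰⇒> (λ Rℓ≤y → none (ℓ , σℓ≡i , Rℓ≤y))))))

      tall-job : ∀ {x} → 0ℚ ≤ x → x < makespan σ → ∃[ j ] x < suffixLoad j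
      tall-job {x} 0≤x x<M =
        ℓ , proj₁ (when-pos (x <? suffixLoad ℓ) (proj₂ (when-pos (σ ℓ Fin.≟ i) 0<termℓ)))
        where
        i = proj₁ (<maxFin⇒<term m (load σ) 0≤x x<M)

        x<Lᵢ : x < load σ i
        x<Lᵢ = proj₂ (<maxFin⇒<term m (load σ) 0≤x x<M)

        0<gap : 0ℚ < work σ i - s i * x
        0<gap = p<q⇒0<q-p (subst (s i * x <_) (s*load σ i) (*-monoˡ-<-pos (spos i) x<Lᵢ))

        term : Fin n → ℚ
        term ℓ = when (does (σ ℓ Fin.≟ i)) (when (does (x <? suffixLoad ℓ)) (p ℓ))

        ℓ = proj₁ (sumFin-pos⇒term-pos n term (<-≤-trans 0<gap (workAbove-≥ i 0≤x)))

        0<termℓ : 0ℚ < term ℓ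
        0<termℓ = proj₂ (sumFin-pos⇒term-pos n term (<-≤-trans 0<gap (workAbove-≥ i 0≤x)))

    module Halving (C : ℚ) (0<C : 0ℚ < C) (τ : Schedule m n) (load-τ≤C : ∀ i → load τ i ≤ C)
      (σ : Schedule m n) (π : Permutation′ n)
      (near : ∀ i i' j → ¬ i' ≡ i → σ j ≡ i →
              load σ i - onMachine i (earlierWork σ π i j) ≤ load σ i' + onMachine i' (p j)) where

      open Optimum C 0<C τ load-τ≤C
      open NearList σ π near

      JobAbove : ℚ → ℚ → Set
      JobAbove x u = ∃[ j ] x < suffixLoad j × p j ≤ u

      JobAbove-antimono : ∀ {x x' u} → x' ≤ x → JobAbove x u → JobAbove x' u
      JobAbove-antimono x'≤x (j , x<R , pj≤u) = j , ≤-<-trans x'≤x x<R , pj≤u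

      busy-above : ∀ {x y D w j} → 0ℚ ≤ y → x < suffixLoad j → 0ℚ ≤ D →
                   (∀ i → w ≤ s i * C → p j ≤ s i * D) →
                   (x - D - y) * fastSpeed w ≤ sumFin n (λ ℓ → when (does (y <? suffixLoad ℓ)) (p ℓ))
      busy-above {x} {y} {D} {w} {j} 0≤y x<R 0≤D fits = begin
        (x - D - y) * fastSpeed w
          ≡⟨ *-distribˡ-sumFin m (x - D - y) _ ⟩
        sumFin m (λ i → (x - D - y) * when (does (fits? i)) (s i))
          ≡⟨ sumFin-cong m (λ i → *-when (does (fits? i)) (x - D - y) (s i)) ⟩
        sumFin m (λ i → when (does (fits? i)) ((x - D - y) * s i))
          ≤⟨ sumFin-mono-≤ m (λ i → when-mono-≤ (fits? i) (machine-busy i)) ⟩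
        sumFin m (λ i → when (does (fits? i)) (workAbove y i))
          ≤⟨ sumFin-mono-≤ m (λ i → when-≤ (does (fits? i)) (workAbove-nonneg y i)) ⟩
        sumFin m (workAbove y)
          ≡⟨ sumFin-fibres m n σ (λ _ → true) (λ ℓ → when (does (y <? suffixLoad ℓ)) (p ℓ)) ⟩
        sumFin n (λ ℓ → when (does (y <? suffixLoad ℓ)) (p ℓ)) ∎
        where
        open ℚ.≤-Reasoning
        fits? : ∀ i → Dec (w ≤ s i * C)
        fits? i = w ≤? s i * C
        rearrange : ∀ x D y s → (x - D - y) * s ≡ s * (x - D) - s * y
        rearrange = solve 4 (λ x D y s → (x :- D :- y) :* s := s :* (x :- D) :- s :* y) refl
        machine-busy : ∀ i → w ≤ s i * C → (x - D - y) * s i ≤ workAbove y i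
        machine-busy i w-fits = begin
          (x - D - y) * s i         ≡⟨ rearrange x D y (s i) ⟩
          s i * (x - D) - s i * y   ≤⟨ -‿mono-≤ (work-lower-bound i x<R 0≤D (fits i w-fits))
                                                 (≤-refl {s i * y}) ⟩
          work σ i - s i * y        ≤⟨ workAbove-≥ i 0≤y ⟩
          workAbove y i             ∎

      halve : ∀ N {u} → 0ℚ < u → JobAbove (level (4 ℕ.+ N)) u → JobAbove (level N) (½ * u)
      halve N {u} 0<u (j , x<Rj , pj≤u) with any? (λ ℓ → (level N <? suffixLoad ℓ) ×-dec (p ℓ ≤? ½ * u))
      ... | yes found = found
      ... | no none   = ⊥-elim (p+p≰p 0<C*S (begin
        C * S + C * S     ≡⟨ gap C S y ⟩
        (x - (C + C) - y) * S
          ≤⟨ busy-above (level-nonneg N) x<Rj (ℚ.+-mono-≤ (<⇒≤ 0<C) (<⇒≤ 0<C)) fits ⟩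
        sumFin n (λ ℓ → when (does (y <? suffixLoad ℓ)) (p ℓ))
          ≤⟨ big-jobs-work (½ * u) (λ ℓ → y <? suffixLoad ℓ) big ⟩
        C * S ∎))
        where
        open ℚ.≤-Reasoning
        x = level (4 ℕ.+ N)
        y = level N
        S = fastSpeed (½ * u)
        big : ∀ ℓ → y < suffixLoad ℓ → ½ * u ≤ p ℓ
        big ℓ y<Rℓ = <⇒≤ (ℚ.≰⇒> (λ pℓ≤u/2 → none (ℓ , y<Rℓ , pℓ≤u/2)))
        y<Rj : y < suffixLoad j
        y<Rj = ≤-<-trans (level-mono (ℕ.m≤n+m N 4)) x<Rj
        halves : ∀ u → ½ * u + ½ * u ≡ u
        halves = solve 1 (λ u → con ½ :* u :+ con ½ :* u := u) refl
        fits : ∀ i → ½ * u ≤ s i * C → p j ≤ s i * (C + C)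
        fits i u/2-fits = begin
          p j                  ≤⟨ pj≤u ⟩
          u                    ≡⟨ halves u ⟨
          ½ * u + ½ * u        ≤⟨ ℚ.+-mono-≤ u/2-fits u/2-fits ⟩
          s i * C + s i * C    ≡⟨ ℚ.*-distribˡ-+ (s i) C C ⟨
          s i * (C + C)        ∎
        0<C*S : 0ℚ < C * S
        0<C*S = *-pos 0<C (<-≤-trans (spos (τ j))
          (speed≤fastSpeed (τ j) (≤-trans (big j y<Rj) (job≤speed*C j))))
        gap : ∀ c S y → c * S + c * S ≡ ((c + (c + (c + (c + y)))) - (c + c) - y) * S
        gap = solve 3 (λ c S y →
          c :* S :+ c :* S := ((c :+ (c :+ (c :+ (c :+ y)))) :- (c :+ c) :- y) :* S) refl

      halve-iter : ∀ K N {u} → 0ℚ < u → JobAbove (level (K ℕ.* 4 ℕ.+ N)) u → JobAbove (level N) (½ ^ℕ K * u)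
      halve-iter zero    N {u} _   above = subst (JobAbove (level N)) (sym (ℚ.*-identityˡ u)) above
      halve-iter (suc K) N {u} 0<u above = subst (JobAbove (level N)) (reassociate (½ ^ℕ K) ½ u)
        (halve-iter K N (*-pos 0<½ 0<u) (halve (K ℕ.* 4 ℕ.+ N) 0<u above))
        where
        reassociate : ∀ a b c → a * (b * c) ≡ (b * a) * c
        reassociate = solve 3 (λ a b c → a :* (b :* c) := (b :* a) :* c) refl

      half-jobs-light : ∀ {δ} → 0ℚ < δ → JobAbove (level 3) δ → n ℕ.≤ 2 ℕ.* countFin n (λ j → p j ≤? δ)
      half-jobs-light {δ} 0<δ (j , x<Rj , pj≤δ) =
        half-light-by-weight n p 0<δ (≤-trans heavy≤C*S C*S≤light)
        where
        open ℚ.≤-Reasoning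
        S = fastSpeed δ
        light = sumFin n (λ ℓ → when (does (p ℓ ≤? δ)) (p ℓ))
        heavy = sumFin n (λ ℓ → when (does (¬? (p ℓ ≤? δ))) (p ℓ))
        heavy≤C*S : heavy ≤ C * S
        heavy≤C*S = big-jobs-work δ (λ ℓ → ¬? (p ℓ ≤? δ)) (λ ℓ → <⇒≤ ∘ ℚ.≰⇒>)
        gap : ∀ c S → c * S + c * S ≡ ((c + (c + (c + 0ℚ))) - c - 0ℚ) * S
        gap = solve 2 (λ c S →
          c :* S :+ c :* S := ((c :+ (c :+ (c :+ con 0ℚ))) :- c :- con 0ℚ) :* S) refl
        C*S≤light : C * S ≤ light
        C*S≤light = +-cancelʳ-≤ (C * S) (begin
          C * S + C * S     ≡⟨ gap C S ⟩
          (level 3 - C - 0ℚ) * S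
            ≤⟨ busy-above ≤-refl x<Rj (<⇒≤ 0<C) (λ i δ-fits → ≤-trans pj≤δ δ-fits) ⟩
          sumFin n (λ ℓ → when (does (0ℚ <? suffixLoad ℓ)) (p ℓ))
            ≤⟨ sumFin-mono-≤ n (λ ℓ → when-≤ (does (0ℚ <? suffixLoad ℓ)) (0≤p ℓ)) ⟩
          sumFin n p
            ≡⟨ sumFin-cong n (λ ℓ → when-split (does (p ℓ ≤? δ)) (p ℓ)) ⟩
          sumFin n (λ ℓ → when (does (p ℓ ≤? δ)) (p ℓ) + when (does (¬? (p ℓ ≤? δ))) (p ℓ))
            ≡⟨ sumFin-distrib-+ n _ _ ⟩
          light + heavy     ≤⟨ ℚ.+-monoʳ-≤ light heavy≤C*S ⟩
          light + C * S     ∎)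

      half-jobs-tiny : (∀ j → p j ≤ 1ℚ) → ∀ d → level (14 ℕ.+ d) ≤ makespan σ →
                        n ℕ.≤ 2 ℕ.* countFin n (λ j → (p j ^ℕ 6) ≤? pow2ℤ -[1+ d ])
      half-jobs-tiny p≤1 d level≤M with halvings d
      ... | K , d<6K , 4K+3≤13+d = ℕ.≤-trans (half-jobs-light (*-pos (½^-pos K) 0<1) above)
                                     (ℕ.*-monoʳ-≤ 2 (countFin-mono n _ _ small⇒tiny))
        where
        level<M : level (13 ℕ.+ d) < makespan σ
        level<M = <-≤-trans (subst (_< level (14 ℕ.+ d)) (ℚ.+-identityˡ _) (ℚ.+-monoˡ-< _ 0<C)) level≤M
        top : JobAbove (level (K ℕ.* 4 ℕ.+ 3)) 1ℚ
        top = let j , x<Rj = tall-job (level-nonneg (13 ℕ.+ d)) level<M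
              in JobAbove-antimono (level-mono 4K+3≤13+d) (j , x<Rj , p≤1 j)
        above : JobAbove (level 3) (½ ^ℕ K * 1ℚ)
        above = halve-iter K 3 0<1 top
        small⇒tiny : ∀ j → p j ≤ ½ ^ℕ K * 1ℚ → p j ^ℕ 6 ≤ ½ ^ℕ suc d
        small⇒tiny j pj≤δ = begin
          p j ^ℕ 6               ≤⟨ ^ℕ-mono-≤ 6 (0≤p j) pj≤δ ⟩
          (½ ^ℕ K * 1ℚ) ^ℕ 6     ≡⟨ cong (_^ℕ 6) (ℚ.*-identityʳ (½ ^ℕ K)) ⟩
          (½ ^ℕ K) ^ℕ 6          ≡⟨ ^ℕ-* ½ K 6 ⟩
          ½ ^ℕ (K ℕ.* 6)         ≤⟨ ½^-antimono d<6K ⟩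
          ½ ^ℕ suc d             ∎
          where open ℚ.≤-Reasoning

      half-jobs-below-exponent : (∀ j → p j ≤ 1ℚ) → ∀ f → (∀ N → f ≡ + N → level N ≤ makespan σ) →
        n ℕ.≤ 2 ℕ.* countFin n (λ j → (p j ^ℕ 6) ≤? pow2ℤ (+ 12 ℤ.- (f ℤ.- + 1)))
      half-jobs-below-exponent p≤1 f floor-level with + 12 ℤ.- (f ℤ.- + 1) in e
      ... | + k      = all-jobs-light p≤1 k
      ... | -[1+ d ] = half-jobs-tiny p≤1 d (floor-level (14 ℕ.+ d) (12-[f-1]≡-[1+d]⇒f≡14+d f d e))

open import Defs
open import Data.Nat as ℕ using (ℕ)
open import Data.Integer as ℤ using (ℤ; +_)
open import Data.Fin using (Fin; _≤_)
open import Data.Rational as ℚ using (ℚ; 0ℚ; 1ℚ; _÷_; floor; >-nonZero)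
open import Data.Rational.Properties using (_≤?_)
open import Data.Product using (_,_)
open import Relation.Binary.PropositionalEquality using (subst)
open Preliminaries using (maxFin-≥)
open RelatedMachines using (module NearListBounds)

corollary16 : (m n : ℕ) (s : Fin m → ℚ) (spos : ∀ i → 0ℚ ℚ.< s i) (p : Fin n → ℚ) →
    (∀ i i' → i ≤ i' → s i' ℚ.≤ s i) →
    (∀ j → 0ℚ ℚ.≤ p j) → (∀ j → p j ℚ.≤ 1ℚ) →
    (Cstar : ℚ) → (Cpos : 0ℚ ℚ.< Cstar) →
    Scheduling.IsOptimalMakespan m n s spos p Cstar →
    (σ : Schedule m n) → Scheduling.NearListSchedule m n s spos p σ →
    let c : ℤ
        c = floor (_÷_ (Scheduling.makespan m n s spos p σ) Cstar {{>-nonZero Cpos}}) ℤ.- + 1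
    in n ℕ.≤ 2 ℕ.* countFin n (λ j → (p j ^ℕ 6) ≤? pow2ℤ (+ 12 ℤ.- c))
corollary16 m n s spos p _ 0≤p p≤1 C 0<C ((τ , makespan-τ≡C) , _) σ (π , near) =
  half-jobs-below-exponent p≤1 (floor (_÷_ (makespan σ) C {{>-nonZero 0<C}}))
    (floor≡⇒level≤ (makespan σ))
  where
  open Scheduling m n s spos p
  open NearListBounds m n s spos p 0≤p
  load-τ≤C : ∀ i → load τ i ℚ.≤ C
  load-τ≤C i = subst (load τ i ℚ.≤_) makespan-τ≡C (maxFin-≥ m (load τ) i)
  open Optimum C 0<C τ load-τ≤C using (floor≡⇒level≤)
  open Halving C 0<C τ load-τ≤C σ π near using (half-jobs-below-exponent)
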